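{- Let $G$ and $H$ be connected graphs, each with at least two vertices, and let $S$ be a nonempty cycle convex set of $G\,\square\,H$ that induces a connected subgraph of $G\,\square\,H$. Then (1) $S=\pi_G(S)\times\pi_H(S)$, and (2) $\pi_G(S)$ is cycle convex in $G$ and $\pi_H(S)$ is cycle convex in $H$.
   Context: All graphs are finite, simple and undirected; $G[X]$ denotes the subgraph induced by $X$. The Cartesian product $G\,\square\,H$ has vertex set $V(G)\times V(H)$, with $(g_1,h_1)$ adjacent to $(g_2,h_2)$ iff either $g_1g_2\in E(G)$ and $h_1=h_2$, or $g_1=g_2$ and $h_1h_2\in E(H)$. For $X\subseteq V(G)\times V(H)$, $\pi_G(X)=\{g: (g,h)\in X \text{ for some } h\}$ and $\pi_H(X)=\{h:(g,h)\in X\text{ for some } g\}$. In a graph $F$, a set $S\subseteq V(F)$ is cycle convex if for every $u\in V(F)\setminus S$ the graph $F[S\cup\{u\}]$ contains no cycle passing through $u$. -}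

module Defs where

open import Level using (0ℓ)
open import Data.Nat using (ℕ; _≤_)
open import Data.Fin using (Fin)
open import Data.Bool using (Bool; true)
open import Data.Product using (_×_; _,_; ∃)
open import Data.List using (List; []; _∷_; _++_; length)
open import Data.List.Relation.Unary.All using (All)
open import Data.List.Relation.Unary.Linked using (Linked)
open import Data.List.Relation.Unary.Unique.Propositional using (Unique)
open import Data.Unit using (⊤)
open import Relation.Nullary using (¬_)
open import Relation.Binary.PropositionalEquality using (_≡_)
open import Relation.Binary using (Decidable)

record Graph : Set₁ where
  field
    n      : ℕ
    Adj    : Fin n → Fin n → Set
    adj?   : Decidable Adj
    sym    : ∀ {x y} → Adj x y → Adj y x
    irrefl : ∀ {x} → ¬ Adj x x

Vertex : Graph → Set
Vertex G = Fin (Graph.n G)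

data Walk {V : Set} (Adj : V → V → Set) (P : V → Set) : V → V → Set where
  here : ∀ {x} → P x → Walk Adj P x x
  step : ∀ {x y z} → P x → Adj x y → Walk Adj P y z → Walk Adj P x z

InducesConnected : {V : Set} → (V → V → Set) → (V → Set) → Set
InducesConnected Adj P = ∀ {x y} → P x → P y → Walk Adj P x y

-- A cycle through u in the subgraph induced by P ∪ {u}:
-- distinct vertices u, v₁, …, vₖ (k ≥ 2) in P ∪ {u}, consecutive ones adjacent
-- and vₖ adjacent to u.
record CycleThrough {V : Set} (Adj : V → V → Set) (P : V → Set) (u : V) : Set where
  field
    rest    : List V
    long    : 2 ≤ length rest
    distinct : Unique (u ∷ rest)
    closed  : Linked Adj (u ∷ rest ++ u ∷ [])
    inside  : All P rest

CycleConvex : {V : Set} → (V → V → Set) → (V → Set) → Set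
CycleConvex Adj P = ∀ u → ¬ P u → ¬ CycleThrough Adj P u

Connected : Graph → Set
Connected G = InducesConnected (Graph.Adj G) (λ _ → ⊤)

□Adj : (G H : Graph) → Vertex G × Vertex H → Vertex G × Vertex H → Set
□Adj G H (g₁ , h₁) (g₂ , h₂) = (Graph.Adj G g₁ g₂ × h₁ ≡ h₂) Data.Sum.⊎ (g₁ ≡ g₂ × Graph.Adj H h₁ h₂)
  where import Data.Sum

-- A subset of V(G □ H), given by its (decidable) characteristic function.
Mem : {V : Set} → (V → Bool) → V → Set
Mem S v = S v ≡ true

πG : {G H : Graph} → (Vertex G × Vertex H → Bool) → Vertex G → Set
πG {G} {H} S g = ∃ λ (h : Vertex H) → Mem S (g , h)

πH : {G H : Graph} → (Vertex G × Vertex H → Bool) → Vertex H → Set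
πH {G} {H} S h = ∃ λ (g : Vertex G) → Mem S (g , h)

-- A cycle-convex S must contain the fourth corner of every square of G □ H of which it
-- contains three, since otherwise that corner closes a 4-cycle through it.  Hence a walk
-- inside S that starts at (g, h₁) can be followed in the H-fibre over g: a step along H
-- is copied, and a step along G is undone by pushing the rest of the walk back through
-- such squares.  So if (g, h₁) and (g₂, h) lie in S, the walk inside S joining them
-- yields (g, h) ∈ S, which is S = π_G(S) × π_H(S).  A fibre G × {h} then meets S in a
-- copy of π_G(S), and a cycle witnessing non-convexity of π_G(S) would lift to one in
-- that fibre.
module Submission where

open import Defs
open import Data.Nat using (_≤_; s≤s; z≤n)
open import Data.Bool using (Bool; true; _≟_)
open import Data.Product using (_×_; _,_; ∃; proj₁; proj₂)
open import Data.Product.Properties using (,-injectiveˡ; ,-injectiveʳ)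
open import Data.Sum using (inj₁; inj₂)
open import Data.List using ([]; _∷_; map)
open import Data.List.Properties using (map-++; length-map)
import Data.List.Relation.Unary.All.Properties as All
open import Data.List.Relation.Unary.AllPairs using ([]; _∷_)
open import Data.List.Relation.Unary.All using ([]; _∷_)
open import Data.List.Relation.Unary.Linked as Linked using (Linked; [-]; _∷_)
import Data.List.Relation.Unary.Linked.Properties as Linked
import Data.List.Relation.Unary.Unique.Propositional.Properties as Unique
open import Function using (_∘_)
open import Function.Bundles using (_⇔_; mk⇔; Equivalence)
open import Function.Definitions using (Injective)
open import Relation.Binary.PropositionalEquality using (_≡_; _≢_; refl; sym; subst)
open import Relation.Nullary using (Dec)
open import Relation.Nullary.Decidable using (decidable-stable)

module _ {V : Set} {Adj : V → V → Set} {P : V → Set} where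

  Walk-source : ∀ {x y} → Walk Adj P x y → P x
  Walk-source (here p)     = p
  Walk-source (step p _ _) = p

  Walk-target : ∀ {x y} → Walk Adj P x y → P y
  Walk-target (here p)     = p
  Walk-target (step _ _ w) = Walk-target w

  CycleConvex⇒cycle-closed : CycleConvex Adj P → ∀ {u} → Dec (P u) → CycleThrough Adj P u → P u
  CycleConvex⇒cycle-closed convex P? cycle = decidable-stable P? (λ ¬Pu → convex _ ¬Pu cycle)

module _ {A B : Set} {R : A → A → Set} {R′ : B → B → Set} {P : A → Set} {Q : B → Set}
         (f : A → B) (f-injective : Injective _≡_ _≡_ f)
         (f-homo : ∀ {x y} → R x y → R′ (f x) (f y)) where

  CycleThrough-map : (∀ {x} → P x → Q (f x)) → ∀ {u} → CycleThrough R P u → CycleThrough R′ Q (f u)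
  CycleThrough-map P⇒Q∘f {u} c = record
    { rest     = map f rest
    ; long     = subst (2 ≤_) (sym (length-map f rest)) long
    ; distinct = Unique.map⁺ f-injective distinct
    ; closed   = subst (λ l → Linked R′ (f u ∷ l)) (map-++ f rest (u ∷ []))
                   (Linked.map⁺ (Linked.map f-homo closed))
    ; inside   = All.gmap⁺ P⇒Q∘f inside
    }
    where open CycleThrough c

  CycleConvex-pullback : (∀ x → P x ⇔ Q (f x)) → CycleConvex R′ Q → CycleConvex R P
  CycleConvex-pullback P⇔Q∘f convex u ¬Pu cycle =
    convex (f u) (¬Pu ∘ Equivalence.from (P⇔Q∘f u))
      (CycleThrough-map (Equivalence.to (P⇔Q∘f _)) cycle)

Adj⇒≢ : (G : Graph) → ∀ {x y} → Graph.Adj G x y → x ≢ y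
Adj⇒≢ G xy refl = Graph.irrefl G xy

module CycleConvexInProduct (G H : Graph) {P : Vertex G × Vertex H → Set}
                            (P? : ∀ v → Dec (P v)) (convex : CycleConvex (□Adj G H) P) where
  module G = Graph G
  module H = Graph H

  square-closed : ∀ {x x′ y y′} → G.Adj x x′ → H.Adj y y′ →
    P (x , y) → P (x′ , y) → P (x , y′) → P (x′ , y′)
  square-closed {x} {x′} {y} {y′} xx′ yy′ p p′ q = CycleConvex⇒cycle-closed convex (P? _) record
    { rest     = (x′ , y) ∷ (x , y) ∷ (x , y′) ∷ []
    ; long     = s≤s (s≤s z≤n)
    ; distinct = (y′≢y ∘ ,-injectiveʳ ∷ x′≢x ∘ ,-injectiveˡ ∷ x′≢x ∘ ,-injectiveˡ ∷ [])
               ∷ (x′≢x ∘ ,-injectiveˡ ∷ x′≢x ∘ ,-injectiveˡ ∷ [])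
               ∷ (y′≢y ∘ sym ∘ ,-injectiveʳ ∷ [])
               ∷ [] ∷ []
    ; closed   = inj₂ (refl , H.sym yy′) ∷ inj₁ (G.sym xx′ , refl)
               ∷ inj₂ (refl , yy′) ∷ inj₁ (xx′ , refl) ∷ [-]
    ; inside   = p′ ∷ p ∷ q ∷ []
    }
    where
    x′≢x : x′ ≢ x
    x′≢x = Adj⇒≢ G (G.sym xx′)
    y′≢y : y′ ≢ y
    y′≢y = Adj⇒≢ H (H.sym yy′)

  FibreWalk : Vertex G → Vertex H → Vertex H → Set
  FibreWalk g = Walk H.Adj (λ h → P (g , h))

  FibreWalk-shift : ∀ {g g′ h h′} → G.Adj g g′ → P (g , h) → FibreWalk g′ h h′ → FibreWalk g h h′
  FibreWalk-shift gg′ p (here _)        = here p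
  FibreWalk-shift gg′ p (step p′ hh″ w) =
    step p hh″ (FibreWalk-shift gg′ (square-closed (G.sym gg′) hh″ p′ p (Walk-source w)) w)

  Walk⇒FibreWalk : ∀ {v w} → Walk (□Adj G H) P v w → FibreWalk (proj₁ v) (proj₂ v) (proj₂ w)
  Walk⇒FibreWalk (here p)                        = here p
  Walk⇒FibreWalk (step p (inj₁ (gg′ , refl)) w) = FibreWalk-shift gg′ p (Walk⇒FibreWalk w)
  Walk⇒FibreWalk (step p (inj₂ (refl , hh′)) w) = step p hh′ (Walk⇒FibreWalk w)

  rectangle-closed : InducesConnected (□Adj G H) P →
    ∀ {g g′ h h′} → P (g , h′) → P (g′ , h) → P (g , h)
  rectangle-closed connected p p′ = Walk-target (Walk⇒FibreWalk (connected p p′))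

lemma5p3 : (G H : Graph) → Connected G → Connected H →
    2 ≤ Graph.n G → 2 ≤ Graph.n H →
    (S : Vertex G × Vertex H → Bool) →
    (∃ λ v → Mem S v) →
    CycleConvex (□Adj G H) (Mem S) →
    InducesConnected (□Adj G H) (Mem S) →
    (∀ g h → Mem S (g , h) ⇔ (πG {G} {H} S g × πH {G} {H} S h))
    × (CycleConvex (Graph.Adj G) (πG {G} {H} S) × CycleConvex (Graph.Adj H) (πH {G} {H} S))
lemma5p3 G H _ _ _ _ S ((g₀ , h₀) , s₀) convex connected = product , convexG , convexH
  where
  open CycleConvexInProduct G H (λ v → S v ≟ true) convex

  product : ∀ g h → Mem S (g , h) ⇔ (πG {G} {H} S g × πH {G} {H} S h)
  product g h = mk⇔ (λ s → (h , s) , (g , s))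
                    (λ ((_ , s) , (_ , s′)) → rectangle-closed connected s s′)

  convexG : CycleConvex (Graph.Adj G) (πG {G} {H} S)
  convexG = CycleConvex-pullback (_, h₀) ,-injectiveˡ (λ gg′ → inj₁ (gg′ , refl))
    (λ g → mk⇔ (λ p → Equivalence.from (product g h₀) (p , (g₀ , s₀))) (h₀ ,_)) convex

  convexH : CycleConvex (Graph.Adj H) (πH {G} {H} S)
  convexH = CycleConvex-pullback (g₀ ,_) ,-injectiveʳ (λ hh′ → inj₂ (refl , hh′))
    (λ h → mk⇔ (λ p → Equivalence.from (product g₀ h) ((h₀ , s₀) , p)) (g₀ ,_)) convex
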